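{- Let $\lambda=(m,n)$ be a triangular $2$-partition and $\mu=(\mu_1,\mu_2)$, $\tau=(\tau_1,\tau_2)$ two subpartitions of $\lambda$ such that $\tau$ is on the right side. Then $\tau\preceq\mu$ in the $\nu$-Tamari lattice of $\lambda$ if and only if $\mu\subseteq\tau$ and $\tau_1-\mu_1\ge\tau_2-\mu_2$.
   Context: A $2$-partition $(m,n)$ has $m\ge n\ge0$; it is triangular if there exist positive reals $r,s$ with $\lambda_j=\lfloor r-jr/s\rfloor$ for $1\le j\le s$ and $\lambda_j=0$ for $j>s$. $\mu\subseteq\tau$ means $\mu_1\le\tau_1$ and $\mu_2\le\tau_2$. A subpartition $(m-i,n-j)$ is on the left side if $i<j$, in the center if $i=j$, on the right side if $i>j$. $\nu$-Tamari order: for a subpartition $\mu$ and a line $j$ (rows counted $1,2,\dots$ from the bottom) with $\mu_j>\mu_{j+1}$, let $v=\lambda_j-\mu_j$ and $i_0$ the smallest integer with $0\le i_0<j$ such that $\lambda_k-\mu_k>v$ for all $i_0<k<j$; the rotation at line $j$ gives $\alpha$ with $\alpha_k=\mu_k-1$ for $i_0<k\le j$ and $\alpha_k=\mu_k$ otherwise; $\preceq$ is the reflexive-transitive closure of rotations.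
   Formalization: The parameters r, s in the definition of a triangular partition range over the positive rationals instead of the positive reals. -}

module Defs where

open import Data.Nat using (ℕ; zero; suc; _≤_; _<_; _∸_; _+_)
open import Data.Integer using (ℤ; +_)
open import Data.Rational as ℚ using (ℚ; floor; _÷_; Positive; _/_; _*_; _-_)
open import Data.Rational.Properties using (pos⇒nonZero)
open import Data.Product using (Σ; _×_; _,_)
open import Relation.Binary.PropositionalEquality using (_≡_)
open import Relation.Binary.Construct.Closure.ReflexiveTransitive using (Star)

-- The 2-partition λ = (m , n) as an infinite sequence of row lengths,
-- rows indexed 1, 2, 3, … from the bottom (index 0 is unused).
row : ℕ → ℕ → ℕ → ℕ
row m n 1 = m
row m n 2 = n
row m n _ = 0

TwoPartition : ℕ → ℕ → Set
TwoPartition m n = n ≤ m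

ℕ→ℚ : ℕ → ℚ
ℕ→ℚ j = (+ j) / 1

_÷⁺_ : (p q : ℚ) → Positive q → ℚ
(p ÷⁺ q) pq = _÷_ p q {{pos⇒nonZero q {{pq}}}}

Triangular : ℕ → ℕ → Set
Triangular m n =
  Σ ℚ λ r → Σ ℚ λ s → Σ (Positive r) λ _ → Σ (Positive s) λ ps →
    ∀ (j : ℕ) → 1 ≤ j →
      (ℚ._≤_ (ℕ→ℚ j) s → + (row m n j) ≡ floor (r - ((ℕ→ℚ j * r) ÷⁺ s) ps))
      × (ℚ._<_ s (ℕ→ℚ j) → row m n j ≡ 0)

SubPart : ℕ → ℕ → ℕ × ℕ → Set
SubPart m n (μ₁ , μ₂) = μ₂ ≤ μ₁ × μ₁ ≤ m × μ₂ ≤ n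

_⊆_ : ℕ × ℕ → ℕ × ℕ → Set
(μ₁ , μ₂) ⊆ (τ₁ , τ₂) = μ₁ ≤ τ₁ × μ₂ ≤ τ₂

-- τ = (m - i , n - j) is on the right side iff i > j.
RightSide : ℕ → ℕ → ℕ × ℕ → Set
RightSide m n (τ₁ , τ₂) = n ∸ τ₂ < m ∸ τ₁

-- One rotation μ ↦ α in the ν-Tamari order of λ = (m , n), specialised to
-- two rows (μ₃ = 0):
--  * line 1 (needs μ₁ > μ₂): i₀ = 0, α = (μ₁ - 1 , μ₂);
--  * line 2 (needs μ₂ > 0): v = n - μ₂; i₀ = 0 if m - μ₁ > v, giving
--    α = (μ₁ - 1 , μ₂ - 1); otherwise i₀ = 1, giving α = (μ₁ , μ₂ - 1).
data Rot (m n : ℕ) : ℕ × ℕ → ℕ × ℕ → Set where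
  line1 : ∀ {μ₁ μ₂} → SubPart m n (suc μ₁ , μ₂) → μ₂ < suc μ₁ →
          Rot m n (suc μ₁ , μ₂) (μ₁ , μ₂)
  line2-i0=0 : ∀ {μ₁ μ₂} → SubPart m n (μ₁ , suc μ₂) →
          n ∸ suc μ₂ < m ∸ μ₁ →
          Rot m n (μ₁ , suc μ₂) (μ₁ ∸ 1 , μ₂)
  line2-i0=1 : ∀ {μ₁ μ₂} → SubPart m n (μ₁ , suc μ₂) →
          m ∸ μ₁ ≤ n ∸ suc μ₂ →
          Rot m n (μ₁ , suc μ₂) (μ₁ , μ₂)

_⪯[_,_]_ : ℕ × ℕ → ℕ → ℕ → ℕ × ℕ → Set
μ ⪯[ m , n ] α = Star (Rot m n) μ α

-- On the right side a rotation at line 2 always has i₀ = 0, so every rotation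
-- removes either the last cell of row 1 or the last cell of each row, and the
-- result stays on the right side. Hence τ ⪯ μ exactly when μ arises from τ by
-- k diagonal and e horizontal removals, which is the stated inequality; conversely,
-- doing the diagonal removals first keeps every intermediate shape on the right
-- side, so each removal is a rotation.
module Submission where

open import Defs
open import Data.Nat using (ℕ; zero; suc; _+_; _≤_; _∸_; s≤s)
open import Data.Nat.Properties
open import Data.Nat.Tactic.RingSolver using (solve-∀)
open import Data.Product using (_×_; _,_)
open import Data.Empty using (⊥-elim)
open import Function.Base using (_∘_)
open import Function.Bundles using (_⇔_; mk⇔)
open import Relation.Binary.PropositionalEquality
open import Relation.Binary.Construct.Closure.ReflexiveTransitive using (ε; _◅_; _◅◅_)

data _⇘_ : ℕ × ℕ → ℕ × ℕ → Set where
  steps : ∀ k e y₁ y₂ → (k + (e + y₁) , k + y₂) ⇘ (y₁ , y₂)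

⇘-refl : ∀ {x} → x ⇘ x
⇘-refl {x₁ , x₂} = steps 0 0 x₁ x₂

⇘-trans : ∀ {x y z} → x ⇘ y → y ⇘ z → x ⇘ z
⇘-trans (steps k e _ _) (steps k′ e′ z₁ z₂) =
  subst (_⇘ (z₁ , z₂)) (cong₂ _,_ (reassoc k e k′ e′ z₁) (+-assoc k k′ z₂))
    (steps (k + k′) (e + e′) z₁ z₂)
  where
  reassoc : ∀ k e k′ e′ z → (k + k′) + ((e + e′) + z) ≡ k + (e + (k′ + (e′ + z)))
  reassoc = solve-∀

⇘⇒⊆×∸≤∸ : ∀ {x₁ x₂ y₁ y₂} → (x₁ , x₂) ⇘ (y₁ , y₂) →
          (y₁ , y₂) ⊆ (x₁ , x₂) × x₂ ∸ y₂ ≤ x₁ ∸ y₁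
⇘⇒⊆×∸≤∸ (steps k e y₁ y₂) =
  (≤-trans (m≤n+m y₁ e) (m≤n+m (e + y₁) k) , m≤n+m y₂ k) , k≤k+e
  where
  open ≤-Reasoning
  k≤k+e : k + y₂ ∸ y₂ ≤ k + (e + y₁) ∸ y₁
  k≤k+e = begin
    k + y₂ ∸ y₂        ≡⟨ m+n∸n≡m k y₂ ⟩
    k                  ≤⟨ m≤m+n k e ⟩
    k + e              ≡⟨ m+n∸n≡m (k + e) y₁ ⟨
    k + e + y₁ ∸ y₁    ≡⟨ cong (_∸ y₁) (+-assoc k e y₁) ⟩
    k + (e + y₁) ∸ y₁  ∎

⊆×∸≤∸⇒⇘ : ∀ {x₁ x₂ y₁ y₂} → (y₁ , y₂) ⊆ (x₁ , x₂) × x₂ ∸ y₂ ≤ x₁ ∸ y₁ →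
          (x₁ , x₂) ⇘ (y₁ , y₂)
⊆×∸≤∸⇒⇘ {x₁} {x₂} {y₁} {y₂} ((y₁≤x₁ , y₂≤x₂) , k≤d) =
  subst (_⇘ (y₁ , y₂)) (cong₂ _,_ x₁-split (m∸n+n≡m y₂≤x₂)) (steps k e y₁ y₂)
  where
  open ≡-Reasoning
  k e : ℕ
  k = x₂ ∸ y₂
  e = (x₁ ∸ y₁) ∸ k
  x₁-split : k + (e + y₁) ≡ x₁
  x₁-split = begin
    k + (e + y₁)  ≡⟨ +-assoc k e y₁ ⟨
    k + e + y₁    ≡⟨ cong (_+ y₁) (m+[n∸m]≡n k≤d) ⟩
    x₁ ∸ y₁ + y₁  ≡⟨ m∸n+n≡m y₁≤x₁ ⟩
    x₁            ∎

m∸n≤1+m∸[1+n] : ∀ m n → m ∸ n ≤ suc (m ∸ suc n)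
m∸n≤1+m∸[1+n] zero    n       = m≤n⇒m≤1+n (m∸n≤m 0 n)
m∸n≤1+m∸[1+n] (suc m) zero    = ≤-refl
m∸n≤1+m∸[1+n] (suc m) (suc n) = m∸n≤1+m∸[1+n] m n

RightSide-horizontal : ∀ m n a b → RightSide m n (suc a , b) → RightSide m n (a , b)
RightSide-horizontal m n a b rs = <-≤-trans rs (∸-monoʳ-≤ m (n≤1+n a))

RightSide-diagonal : ∀ m n a b → RightSide m n (suc a , suc b) → RightSide m n (a , b)
RightSide-diagonal m n a b rs = begin-strict
  n ∸ b            ≤⟨ m∸n≤1+m∸[1+n] n b ⟩
  suc (n ∸ suc b)  <⟨ s≤s rs ⟩
  suc (m ∸ suc a)  ≤⟨ ∸-monoʳ-< (n<1+n a) (<⇒≤ (m∸n≢0⇒n<m (m<n⇒n≢0 rs))) ⟩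
  m ∸ a            ∎
  where open ≤-Reasoning

rot-RightSide : ∀ {m n x y} → RightSide m n x → Rot m n x y → x ⇘ y × RightSide m n y
rot-RightSide {m} {n} rs (line1 {a} {b} _ _)          = steps 0 1 a b , RightSide-horizontal m n a b rs
rot-RightSide {m} {n} rs (line2-i0=0 {suc a} {b} _ _) = steps 1 0 a b , RightSide-diagonal m n a b rs
rot-RightSide         rs (line2-i0=0 {zero} (() , _ , _) _)
rot-RightSide         rs (line2-i0=1 _ m∸μ₁≤n∸μ₂)   = ⊥-elim (<⇒≱ rs m∸μ₁≤n∸μ₂)

⪯⇒⇘ : ∀ {m n x y} → RightSide m n x → x ⪯[ m , n ] y → x ⇘ y
⪯⇒⇘ rs ε            = ⇘-refl
⪯⇒⇘ rs (rot ◅ rots) =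
  let x⇘x′ , rs′ = rot-RightSide rs rot in ⇘-trans x⇘x′ (⪯⇒⇘ rs′ rots)

horizontal-⪯ : ∀ {m n} e y₁ y₂ → y₂ ≤ y₁ → e + y₁ ≤ m → y₂ ≤ n →
               (e + y₁ , y₂) ⪯[ m , n ] (y₁ , y₂)
horizontal-⪯ zero    y₁ y₂ _     _    _    = ε
horizontal-⪯ (suc e) y₁ y₂ y₂≤y₁ e+y₁<m y₂≤n =
  line1 (m≤n⇒m≤1+n y₂≤e+y₁ , e+y₁<m , y₂≤n) (s≤s y₂≤e+y₁)
  ◅ horizontal-⪯ e y₁ y₂ y₂≤y₁ (<⇒≤ e+y₁<m) y₂≤n
  where
  y₂≤e+y₁ : y₂ ≤ e + y₁
  y₂≤e+y₁ = ≤-trans y₂≤y₁ (m≤n+m y₁ e)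

diagonal-⪯ : ∀ {m n} k x₁ x₂ → x₂ ≤ x₁ → k + x₁ ≤ m → k + x₂ ≤ n →
             RightSide m n (k + x₁ , k + x₂) → (k + x₁ , k + x₂) ⪯[ m , n ] (x₁ , x₂)
diagonal-⪯ zero    x₁ x₂ _     _       _       _  = ε
diagonal-⪯ {m} {n} (suc k) x₁ x₂ x₂≤x₁ k+x₁<m k+x₂<n rs =
  line2-i0=0 (s≤s (+-monoʳ-≤ k x₂≤x₁) , k+x₁<m , k+x₂<n) rs
  ◅ diagonal-⪯ k x₁ x₂ x₂≤x₁ (<⇒≤ k+x₁<m) (<⇒≤ k+x₂<n)
      (RightSide-diagonal m n (k + x₁) (k + x₂) rs)

⇘⇒⪯ : ∀ {m n x₁ x₂ y₁ y₂} → y₂ ≤ y₁ → x₁ ≤ m → x₂ ≤ n → RightSide m n (x₁ , x₂) →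
      (x₁ , x₂) ⇘ (y₁ , y₂) → (x₁ , x₂) ⪯[ m , n ] (y₁ , y₂)
⇘⇒⪯ y₂≤y₁ x₁≤m x₂≤n rs (steps k e y₁ y₂) =
  diagonal-⪯ k (e + y₁) y₂ (≤-trans y₂≤y₁ (m≤n+m y₁ e)) x₁≤m x₂≤n rs
  ◅◅ horizontal-⪯ e y₁ y₂ y₂≤y₁ (≤-trans (m≤n+m (e + y₁) k) x₁≤m) (≤-trans (m≤n+m y₂ k) x₂≤n)

proposition5p16 : (m n : ℕ) → TwoPartition m n → Triangular m n →
    (μ₁ μ₂ τ₁ τ₂ : ℕ) → SubPart m n (μ₁ , μ₂) → SubPart m n (τ₁ , τ₂) →
    RightSide m n (τ₁ , τ₂) →
    ((τ₁ , τ₂) ⪯[ m , n ] (μ₁ , μ₂)) ⇔ (((μ₁ , μ₂) ⊆ (τ₁ , τ₂)) × (τ₂ ∸ μ₂ ≤ τ₁ ∸ μ₁))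
proposition5p16 m n _ _ μ₁ μ₂ τ₁ τ₂ (μ₂≤μ₁ , _) (_ , τ₁≤m , τ₂≤n) rs =
  mk⇔ (⇘⇒⊆×∸≤∸ ∘ ⪯⇒⇘ rs) (⇘⇒⪯ μ₂≤μ₁ τ₁≤m τ₂≤n rs ∘ ⊆×∸≤∸⇒⇘)
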